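{- Let $\mathsf P$ be a special subalgebra of a cubic algebra $\mathcal L$. Then the set of $\mathsf P$-Boolean special subalgebras, ordered by reverse inclusion, is a Boolean algebra in which the meet is $\vee$, the join is $\cap$, the top element is $\{\mathbf 1\}$, the bottom element is $\mathsf P$, and the complement of $\mathsf Q$ is $\mathsf Q\to\mathsf P$.
   Context: A cubic algebra is a join-semilattice $\mathcal L$ with top $\mathbf 1$ and a binary operation $\Delta$ such that: if $x\le y$ then $\Delta(y,x)\vee x=y$; if $x\le y\le z$ then $\Delta(z,\Delta(y,x))=\Delta(\Delta(z,y),\Delta(z,x))$; if $x\le y$ then $\Delta(y,\Delta(y,x))=x$; if $x\le y\le z$ then $\Delta(z,x)\le\Delta(z,y)$; and with $xy:=\Delta(\mathbf 1,\Delta(x\vee y,y))\vee y$ one has $(xy)y=x\vee y$ and $x(yz)=y(xz)$. With $xy$, $\mathcal L$ is an implication algebra; an implication subalgebra is a subset closed under it. A subset $A$ is compatible iff $x\vee\Delta(\mathbf 1,y)=\mathbf 1$ for all $x,y\in A$ (equivalently, its image under every embedding into an interval algebra of a Boolean algebra has the finite intersection property). A special subalgebra is an upwards-closed, compatible implication subalgebra $I$ with $x\wedge y\in I$ whenever $x,y\in I$ and $x\wedge y$ exists in $\mathcal L$. For special subalgebras $\mathsf H,\mathsf K$ with $\mathsf H\cup\mathsf K$ compatible, $\mathsf H\vee\mathsf K$ is the smallest special subalgebra containing $\mathsf H\cup\mathsf K$. For special subalgebras $\mathsf Q\subseteq\mathsf P$, $\mathsf Q\to\mathsf P=\{h\in\mathsf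 P: h\vee g=\mathbf 1\ \forall g\in\mathsf Q\}$. A special subalgebra $\mathsf Q$ is $\mathsf P$-Boolean iff $\mathsf Q\subseteq\mathsf P$ and $\mathsf Q\vee(\mathsf Q\to\mathsf P)=\mathsf P$. -}

module Defs where

open import Level using (Level; _⊔_; suc)
open import Data.Product using (Σ; _×_; _,_; proj₁; proj₂)
open import Relation.Binary.PropositionalEquality using (_≡_)
open import Relation.Unary using (Pred; _∈_; _⊆_; _∪_; _∩_)
open import Algebra.Core using (Op₁; Op₂)
open import Algebra.Lattice.Structures using (IsBooleanAlgebra)

record CubicAlgebra (ℓ : Level) : Set (suc ℓ) where
  infixr 6 _∨_
  infix 4 _≤_
  field
    Carrier : Set ℓ
    _∨_     : Carrier → Carrier → Carrier
    𝟏       : Carrier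
    Δ       : Carrier → Carrier → Carrier
    ∨-assoc : ∀ x y z → (x ∨ y) ∨ z ≡ x ∨ (y ∨ z)
    ∨-comm  : ∀ x y → x ∨ y ≡ y ∨ x
    ∨-idem  : ∀ x → x ∨ x ≡ x

  _≤_ : Carrier → Carrier → Set ℓ
  x ≤ y = x ∨ y ≡ y

  _⇒_ : Carrier → Carrier → Carrier
  x ⇒ y = Δ 𝟏 (Δ (x ∨ y) y) ∨ y

  field
    top    : ∀ x → x ≤ 𝟏
    ax1    : ∀ {x y} → x ≤ y → Δ y x ∨ x ≡ y
    ax2    : ∀ {x y z} → x ≤ y → y ≤ z → Δ z (Δ y x) ≡ Δ (Δ z y) (Δ z x)
    ax3    : ∀ {x y} → x ≤ y → Δ y (Δ y x) ≡ x
    ax4    : ∀ {x y z} → x ≤ y → y ≤ z → Δ z x ≤ Δ z y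
    ax5    : ∀ x y → (x ⇒ y) ⇒ y ≡ x ∨ y
    ax6    : ∀ x y z → x ⇒ (y ⇒ z) ≡ y ⇒ (x ⇒ z)

module _ {ℓ : Level} (L : CubicAlgebra ℓ) where
  open CubicAlgebra L

  IsMeet : Carrier → Carrier → Carrier → Set ℓ
  IsMeet x y m = (m ≤ x) × (m ≤ y) × (∀ z → z ≤ x → z ≤ y → z ≤ m)

  ImplicationSubalgebra : Pred Carrier ℓ → Set ℓ
  ImplicationSubalgebra A = ∀ {x y} → x ∈ A → y ∈ A → (x ⇒ y) ∈ A

  Compatible : Pred Carrier ℓ → Set ℓ
  Compatible A = ∀ {x y} → x ∈ A → y ∈ A → x ∨ Δ 𝟏 y ≡ 𝟏

  UpClosed : Pred Carrier ℓ → Set ℓ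
  UpClosed A = ∀ {x y} → x ∈ A → x ≤ y → y ∈ A

  MeetClosed : Pred Carrier ℓ → Set ℓ
  MeetClosed A = ∀ {x y m} → x ∈ A → y ∈ A → IsMeet x y m → m ∈ A

  -- special subalgebra (implication subalgebras are taken to contain 𝟏,
  -- i.e. to be nonempty)
  record Special (I : Pred Carrier ℓ) : Set ℓ where
    field
      contains-𝟏 : 𝟏 ∈ I
      upClosed   : UpClosed I
      compatible : Compatible I
      implSub    : ImplicationSubalgebra I
      meetClosed : MeetClosed I

  IsJoin : Pred Carrier ℓ → Pred Carrier ℓ → Pred Carrier ℓ → Set (suc ℓ)
  IsJoin H K S =
    Compatible (H ∪ K) × Special S × (H ∪ K) ⊆ S ×
    (∀ (T : Pred Carrier ℓ) → Special T → (H ∪ K) ⊆ T → S ⊆ T)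

  Arrow : Pred Carrier ℓ → Pred Carrier ℓ → Pred Carrier ℓ
  Arrow Q P h = (h ∈ P) × (∀ {g} → g ∈ Q → h ∨ g ≡ 𝟏)

  PBoolean : Pred Carrier ℓ → Pred Carrier ℓ → Set (suc ℓ)
  PBoolean P Q = Special Q × Special P × Q ⊆ P × IsJoin Q (Arrow Q P) P

  One : Pred Carrier ℓ
  One x = x ≡ 𝟏

  _≐_ : Pred Carrier ℓ → Pred Carrier ℓ → Set ℓ
  A ≐ B = (A ⊆ B) × (B ⊆ A)

  PBool : Pred Carrier ℓ → Set (suc ℓ)
  PBool P = Σ (Pred Carrier ℓ) (PBoolean P)

  _≈B_ : ∀ {P} → PBool P → PBool P → Set ℓ
  Q ≈B R = proj₁ Q ≐ proj₁ R

  record PBooleanAlgebra (P : Pred Carrier ℓ) : Set (suc ℓ) where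
    field
      _meet_ : Op₂ (PBool P)
      _join_ : Op₂ (PBool P)
      compl  : Op₁ (PBool P)
      ⊤B     : PBool P
      ⊥B     : PBool P
      isBooleanAlgebra : IsBooleanAlgebra (_≈B_ {P}) _join_ _meet_ compl ⊤B ⊥B
      -- the lattice order (Q ≤ R iff Q meet R ≈ Q) is reverse inclusion
      order-is-reverse-inclusion :
        ∀ Q R → ((Q meet R) ≈B Q → proj₁ R ⊆ proj₁ Q)
              × (proj₁ R ⊆ proj₁ Q → (Q meet R) ≈B Q)
      meet-is-∨  : ∀ Q R → IsJoin (proj₁ Q) (proj₁ R) (proj₁ (Q meet R))
      join-is-∩  : ∀ Q R → proj₁ (Q join R) ≐ (proj₁ Q ∩ proj₁ R)
      top-is-𝟏   : proj₁ ⊤B ≐ One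
      bot-is-P   : proj₁ ⊥B ≐ P
      compl-is-→ : ∀ Q → proj₁ (compl Q) ≐ Arrow (proj₁ Q) P

module Submission where

-- Inside P a
-- set is special as soon as it contains 𝟏 and is up- and meet-closed; with
-- the distributive law this covers annihilators Q → P, intersections, the
-- subalgebra Gen A generated by A ⊆ P, and the shift {y ∈ P : y ∨ c ∈ T}.
-- Minimality applied to shifts gives an induction principle for generated
-- subalgebras; applied to P = Q ∨ (Q → P) it shows that P-Boolean
-- subalgebras are closed under ∩, ∨ and Q ↦ Q → P, and it proves the
-- distributive and complement laws.

open import Defs
open import Level using (Level)
open import Data.Product using (_×_; _,_; proj₁; proj₂)
open import Data.Sum using (inj₁; inj₂; [_,_])
open import Function using (id; _∘_)
open import Relation.Binary.PropositionalEquality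
  using (_≡_; refl; sym; trans; cong; subst; module ≡-Reasoning)
open import Relation.Binary.Structures using (IsEquivalence)
open import Relation.Unary using (Pred; _∈_; _⊆_; _∪_; _∩_; ｛_｝)
open import Algebra.Lattice.Structures using (IsLattice)
open import Algebra.Lattice.Structures.Biased
  using (isDistributiveLatticeʳʲᵐ; isBooleanAlgebraʳ)

module CubicAlgebraProperties {ℓ : Level} (L : CubicAlgebra ℓ) where
  open CubicAlgebra L
  open ≡-Reasoning

  ≤-refl : ∀ x → x ≤ x
  ≤-refl = ∨-idem

  ≤-trans : ∀ {x y z} → x ≤ y → y ≤ z → x ≤ z
  ≤-trans {x} {y} {z} x≤y y≤z = begin
    x ∨ z        ≡⟨ cong (x ∨_) (sym y≤z) ⟩
    x ∨ (y ∨ z)  ≡⟨ sym (∨-assoc x y z) ⟩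
    (x ∨ y) ∨ z  ≡⟨ cong (_∨ z) x≤y ⟩
    y ∨ z        ≡⟨ y≤z ⟩
    z            ∎

  ≤-antisym : ∀ {x y} → x ≤ y → y ≤ x → x ≡ y
  ≤-antisym {x} {y} x≤y y≤x = trans (sym y≤x) (trans (∨-comm y x) x≤y)

  x≤x∨y : ∀ x y → x ≤ x ∨ y
  x≤x∨y x y = trans (sym (∨-assoc x x y)) (cong (_∨ y) (∨-idem x))

  y≤x∨y : ∀ x y → y ≤ x ∨ y
  y≤x∨y x y = subst (y ≤_) (∨-comm y x) (x≤x∨y y x)

  ∨-least : ∀ {x y z} → x ≤ z → y ≤ z → x ∨ y ≤ z
  ∨-least {x} {y} {z} x≤z y≤z = trans (∨-assoc x y z) (trans (cong (x ∨_) y≤z) x≤z)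

  ∨-monoˡ : ∀ {x y} c → x ≤ y → x ∨ c ≤ y ∨ c
  ∨-monoˡ {x} {y} c x≤y = ∨-least (≤-trans x≤y (x≤x∨y y c)) (y≤x∨y y c)

  𝟏≤⇒≡𝟏 : ∀ {x} → 𝟏 ≤ x → x ≡ 𝟏
  𝟏≤⇒≡𝟏 {x} 𝟏≤x = ≤-antisym (top x) 𝟏≤x

  𝟏∨ : ∀ x → 𝟏 ∨ x ≡ 𝟏
  𝟏∨ x = 𝟏≤⇒≡𝟏 (x≤x∨y 𝟏 x)

  meet-of-𝟏 : ∀ {x y m} → IsMeet L x y m → x ≡ 𝟏 → y ≡ 𝟏 → m ≡ 𝟏
  meet-of-𝟏 (_ , _ , glb) x≡𝟏 y≡𝟏 =
    𝟏≤⇒≡𝟏 (glb 𝟏 (subst (𝟏 ≤_) (sym x≡𝟏) (≤-refl 𝟏)) (subst (𝟏 ≤_) (sym y≡𝟏) (≤-refl 𝟏)))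

  Δ-self : ∀ z → Δ z z ≡ z
  Δ-self z = ≤-antisym (ax1 (≤-refl z)) z≤Δzz
    where
      ΔΔ≡z : Δ (Δ z z) (Δ z z) ≡ z
      ΔΔ≡z = trans (sym (ax2 (≤-refl z) (≤-refl z))) (ax3 (≤-refl z))
      z≤Δzz : z ≤ Δ z z
      z≤Δzz = subst (λ w → w ∨ Δ z z ≡ Δ z z) ΔΔ≡z (ax1 (≤-refl (Δ z z)))

  y≤x⇒y : ∀ x y → y ≤ x ⇒ y
  y≤x⇒y x y = y≤x∨y (Δ 𝟏 (Δ (x ∨ y) y)) y

  ≤⇒⇒≡𝟏 : ∀ {x y} → x ≤ y → x ⇒ y ≡ 𝟏
  ≤⇒⇒≡𝟏 {x} {y} x≤y = begin
    Δ 𝟏 (Δ (x ∨ y) y) ∨ y  ≡⟨ cong (λ w → Δ 𝟏 (Δ w y) ∨ y) x≤y ⟩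
    Δ 𝟏 (Δ y y) ∨ y        ≡⟨ cong (λ w → Δ 𝟏 w ∨ y) (Δ-self y) ⟩
    Δ 𝟏 y ∨ y              ≡⟨ ax1 (top y) ⟩
    𝟏                      ∎

  𝟏⇒ : ∀ y → 𝟏 ⇒ y ≡ y
  𝟏⇒ y = begin
    Δ 𝟏 (Δ (𝟏 ∨ y) y) ∨ y  ≡⟨ cong (λ w → Δ 𝟏 (Δ w y) ∨ y) (𝟏∨ y) ⟩
    Δ 𝟏 (Δ 𝟏 y) ∨ y        ≡⟨ cong (_∨ y) (ax3 (top y)) ⟩
    y ∨ y                  ≡⟨ ∨-idem y ⟩
    y                      ∎

  ⇒≡𝟏⇒≤ : ∀ {x y} → x ⇒ y ≡ 𝟏 → x ≤ y
  ⇒≡𝟏⇒≤ {x} {y} x⇒y≡𝟏 = begin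
    x ∨ y          ≡⟨ sym (ax5 x y) ⟩
    (x ⇒ y) ⇒ y    ≡⟨ cong (_⇒ y) x⇒y≡𝟏 ⟩
    𝟏 ⇒ y          ≡⟨ 𝟏⇒ y ⟩
    y              ∎

  residuate : ∀ {x a b} → x ≤ a ⇒ b → a ≤ x ⇒ b
  residuate {x} {a} {b} x≤a⇒b = ⇒≡𝟏⇒≤ (trans (ax6 a x b) (≤⇒⇒≡𝟏 x≤a⇒b))

  ⇒-antitone : ∀ {a a′} b → a ≤ a′ → a′ ⇒ b ≤ a ⇒ b
  ⇒-antitone {a} {a′} b a≤a′ = residuate (subst (a ≤_) (sym (ax5 a′ b)) (≤-trans a≤a′ (x≤x∨y a′ b)))

  ⇒-monotone : ∀ a {b b′} → b ≤ b′ → a ⇒ b ≤ a ⇒ b′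
  ⇒-monotone a {b} {b′} b≤b′ = residuate (subst (a ≤_) same (≤-trans (x≤x∨y a b) (y≤x⇒y (b′ ⇒ b) (a ∨ b))))
    where
      same : (b′ ⇒ b) ⇒ (a ∨ b) ≡ (a ⇒ b) ⇒ b′
      same = begin
        (b′ ⇒ b) ⇒ (a ∨ b)        ≡⟨ cong ((b′ ⇒ b) ⇒_) (sym (ax5 a b)) ⟩
        (b′ ⇒ b) ⇒ ((a ⇒ b) ⇒ b)  ≡⟨ ax6 (b′ ⇒ b) (a ⇒ b) b ⟩
        (a ⇒ b) ⇒ ((b′ ⇒ b) ⇒ b)  ≡⟨ cong ((a ⇒ b) ⇒_) (trans (ax5 b′ b) (trans (∨-comm b′ b) b≤b′)) ⟩
        (a ⇒ b) ⇒ b′              ∎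

  contrapose : ∀ {m u v} → m ≤ u → u ⇒ m ≤ v → v ⇒ m ≤ u
  contrapose {m} {u} {v} m≤u u⇒m≤v =
    subst (v ⇒ m ≤_) (trans (ax5 u m) (trans (∨-comm u m) m≤u)) (⇒-antitone m u⇒m≤v)

  -- Distributive law: joining with x preserves binary meets.  This is
  -- what makes the sets built below closed under existing meets.
  ∨-preserves-meet : ∀ {a b m} x → IsMeet L a b m → IsMeet L (a ∨ x) (b ∨ x) (m ∨ x)
  ∨-preserves-meet {a} {b} {m} x (m≤a , m≤b , glb) = ∨-monoˡ x m≤a , ∨-monoˡ x m≤b , greatest
    where
      m′ = m ∨ x
      below : ∀ {c z} → m ≤ c → z ≤ c ∨ x → (z ⇒ m′) ⇒ m ≤ c
      below {c} {z} m≤c z≤c∨x = contrapose m≤c (≤-trans (⇒-monotone c (x≤x∨y m x)) (residuate z≤))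
        where
          c∨m′≡c∨x : c ∨ m′ ≡ c ∨ x
          c∨m′≡c∨x = trans (sym (∨-assoc c m x)) (cong (_∨ x) (trans (∨-comm c m) m≤c))
          z≤ : z ≤ (c ⇒ m′) ⇒ m′
          z≤ = subst (z ≤_) (trans (sym c∨m′≡c∨x) (sym (ax5 c m′))) z≤c∨x
      greatest : ∀ z → z ≤ a ∨ x → z ≤ b ∨ x → z ≤ m ∨ x
      greatest z z≤a∨x z≤b∨x = ⇒≡𝟏⇒≤ (begin
        z ⇒ m′                 ≡⟨ sym (trans (∨-comm (z ⇒ m′) m) m≤z⇒m′) ⟩
        (z ⇒ m′) ∨ m           ≡⟨ sym (ax5 (z ⇒ m′) m) ⟩
        ((z ⇒ m′) ⇒ m) ⇒ m     ≡⟨ ≤⇒⇒≡𝟏 (glb _ (below m≤a z≤a∨x) (below m≤b z≤b∨x)) ⟩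
        𝟏                      ∎)
        where
          m≤z⇒m′ : m ≤ z ⇒ m′
          m≤z⇒m′ = ≤-trans (x≤x∨y m x) (y≤x⇒y z m′)

module SpecialSubalgebrasOf {ℓ : Level} (L : CubicAlgebra ℓ)
  (P : Pred (CubicAlgebra.Carrier L) ℓ) (SP : Special L P) where
  open CubicAlgebra L
  open CubicAlgebraProperties L
  open Special

  private
    variable
      A C S T : Pred Carrier ℓ

  ∨-closed : Special L T → ∀ c {t} → t ∈ T → t ∨ c ∈ T
  ∨-closed ST c {t} t∈T = upClosed ST t∈T (x≤x∨y t c)

  compatible-in-P : A ⊆ P → Compatible L A
  compatible-in-P A⊆P x∈A y∈A = compatible SP (A⊆P x∈A) (A⊆P y∈A)

  -- Inside P a special subalgebra need only contain 𝟏 and be up- and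
  -- meet-closed: closure under ⇒ follows from up-closure since y ≤ x ⇒ y.
  special-in-P : A ⊆ P → 𝟏 ∈ A → UpClosed L A → MeetClosed L A → Special L A
  special-in-P A⊆P 𝟏∈A up meet = record
    { contains-𝟏 = 𝟏∈A
    ; upClosed   = up
    ; compatible = compatible-in-P A⊆P
    ; implSub    = λ {x} {y} _ y∈A → up y∈A (y≤x⇒y x y)
    ; meetClosed = meet
    }

  ∩-special : Special L A → A ⊆ P → Special L C → Special L (A ∩ C)
  ∩-special SA A⊆P SC = special-in-P (A⊆P ∘ proj₁)
    (contains-𝟏 SA , contains-𝟏 SC)
    (λ (a , c) x≤y → upClosed SA a x≤y , upClosed SC c x≤y)
    (λ (a , c) (a′ , c′) m → meetClosed SA a a′ m , meetClosed SC c c′ m)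

  Shift : Pred Carrier ℓ → Carrier → Pred Carrier ℓ
  Shift T c y = y ∈ P × (y ∨ c) ∈ T

  Shift-special : Special L T → ∀ c → Special L (Shift T c)
  Shift-special ST c = special-in-P proj₁
    (contains-𝟏 SP , ∨-closed ST c (contains-𝟏 ST))
    (λ (p , t) x≤y → upClosed SP p x≤y , upClosed ST t (∨-monoˡ c x≤y))
    (λ (p , t) (p′ , t′) m → meetClosed SP p p′ m , meetClosed ST t t′ (∨-preserves-meet c m))

  Ann : Pred Carrier ℓ → Pred Carrier ℓ
  Ann A = Arrow L A P

  Ann-special : ∀ A → Special L (Ann A)
  Ann-special A = special-in-P proj₁
    (contains-𝟏 SP , λ {g} _ → 𝟏∨ g)
    (λ {h} {h′} (p , h⊥A) h≤h′ → upClosed SP p h≤h′ ,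
       λ {g} g∈A → 𝟏≤⇒≡𝟏 (subst (_≤ h′ ∨ g) (h⊥A g∈A) (∨-monoˡ g h≤h′)))
    (λ (p , h⊥A) (p′ , h′⊥A) m → meetClosed SP p p′ m ,
       λ {g} g∈A → meet-of-𝟏 (∨-preserves-meet g m) (h⊥A g∈A) (h′⊥A g∈A))

  Ann-antitone : A ⊆ C → Ann C ⊆ Ann A
  Ann-antitone A⊆C (p , h⊥C) = p , h⊥C ∘ A⊆C

  Ann-∪ : (Ann A ∩ Ann C) ⊆ Ann (A ∪ C)
  Ann-∪ ((p , h⊥A) , (_ , h⊥C)) = p , [ h⊥A , h⊥C ]

  Ann-swap : C ⊆ P → A ⊆ Ann C → C ⊆ Ann A
  Ann-swap C⊆P A⊆AnnC {c} c∈C = C⊆P c∈C , λ {a} a∈A → trans (∨-comm c a) (proj₂ (A⊆AnnC a∈A) c∈C)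

  Generates : Pred Carrier ℓ → Pred Carrier ℓ → Set (Level.suc ℓ)
  Generates A S = ∀ T → Special L T → A ⊆ T → S ⊆ T

  Generates-mono : A ⊆ C → Generates A S → Generates C S
  Generates-mono A⊆C gen T ST C⊆T = gen T ST (C⊆T ∘ A⊆C)

  data Gen (A : Pred Carrier ℓ) : Pred Carrier ℓ where
    gen      : ∀ {x} → x ∈ A → x ∈ Gen A
    gen-𝟏    : 𝟏 ∈ Gen A
    gen-up   : ∀ {x y} → x ∈ Gen A → x ≤ y → y ∈ Gen A
    gen-meet : ∀ {x y m} → x ∈ Gen A → y ∈ Gen A → IsMeet L x y m → m ∈ Gen A

  Gen-least : Generates A (Gen A)
  Gen-least T ST A⊆T (gen a)          = A⊆T a
  Gen-least T ST A⊆T gen-𝟏            = contains-𝟏 ST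
  Gen-least T ST A⊆T (gen-up x x≤y)   = upClosed ST (Gen-least T ST A⊆T x) x≤y
  Gen-least T ST A⊆T (gen-meet x y m) =
    meetClosed ST (Gen-least T ST A⊆T x) (Gen-least T ST A⊆T y) m

  Gen-in-P : A ⊆ P → Gen A ⊆ P
  Gen-in-P A⊆P = Gen-least P SP A⊆P

  Gen-special : A ⊆ P → Special L (Gen A)
  Gen-special A⊆P = special-in-P (Gen-in-P A⊆P) gen-𝟏 gen-up gen-meet

  Gen-⊆ : C ⊆ P → A ⊆ Gen C → Gen A ⊆ Gen C
  Gen-⊆ C⊆P = Gen-least _ (Gen-special C⊆P)

  Gen-is-join : ∀ {H K} → H ⊆ P → K ⊆ P → IsJoin L H K (Gen (H ∪ K))
  Gen-is-join H⊆P K⊆P =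
    compatible-in-P [ H⊆P , K⊆P ] , Gen-special [ H⊆P , K⊆P ] , gen , Gen-least

  -- Induction principle for generated subalgebras: if S is generated by
  -- A ⊆ P and a ∨ c ∈ T for every generator a, then c ∈ T whenever c lies
  -- above some element of S.  (Apply minimality to the shift of T by c.)
  generated-above : A ⊆ P → Generates A S → Special L T →
    ∀ {s c} → s ∈ S → s ≤ c → (∀ {a} → a ∈ A → a ∨ c ∈ T) → c ∈ T
  generated-above {T = T} A⊆P gens ST {c = c} s∈S s≤c above =
    subst T s≤c (proj₂ (gens (Shift T c) (Shift-special ST c) (λ a → A⊆P a , above a) s∈S))

  Ann-generated : A ⊆ P → Generates A S → Ann A ⊆ Ann S
  Ann-generated A⊆P gens {h} h∈AnnA =
    Ann-swap {C = ｛ h ｝} (λ { refl → proj₁ h∈AnnA })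
      (gens (Ann ｛ h ｝) (Ann-special _) (Ann-swap A⊆P (λ { refl → h∈AnnA })))
      refl

  PB : Set (Level.suc ℓ)
  PB = PBool L P

  ∣_∣ : PB → Pred Carrier ℓ
  ∣ Q ∣ = proj₁ Q

  special : (Q : PB) → Special L ∣ Q ∣
  special (_ , SQ , _) = SQ

  ⊆P : (Q : PB) → ∣ Q ∣ ⊆ P
  ⊆P (_ , _ , _ , Q⊆P , _) = Q⊆P

  generated : (Q : PB) → Generates (∣ Q ∣ ∪ Ann ∣ Q ∣) P
  generated (_ , _ , _ , _ , _ , _ , _ , gens) = gens

  up : (Q : PB) → UpClosed L ∣ Q ∣
  up Q = upClosed (special Q)

  mkPB : ∀ {Q} → Special L Q → Q ⊆ P → Generates (Q ∪ Ann Q) P → PB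
  mkPB {Q} SQ Q⊆P gens =
    Q , SQ , SP , Q⊆P , compatible-in-P Q∪AnnQ⊆P , SP , Q∪AnnQ⊆P , gens
    where
      Q∪AnnQ⊆P : (Q ∪ Ann Q) ⊆ P
      Q∪AnnQ⊆P = [ Q⊆P , proj₁ ]

  gens⊆P : (Q R : PB) → (∣ Q ∣ ∪ ∣ R ∣) ⊆ P
  gens⊆P Q R = [ ⊆P Q , ⊆P R ]

  P-Boolean-above : (Q : PB) → Special L T → ∀ {x c} → x ∈ P → x ≤ c →
    (∀ {q} → q ∈ ∣ Q ∣ → q ∨ c ∈ T) → (∀ {h} → h ∈ Ann ∣ Q ∣ → h ∨ c ∈ T) → c ∈ T
  P-Boolean-above Q ST x∈P x≤c q-case h-case =
    generated-above [ ⊆P Q , proj₁ ] (generated Q) ST x∈P x≤c [ q-case , h-case ]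

  Pᴮ : PB
  Pᴮ = mkPB SP id (Generates-mono inj₁ (λ _ _ → id))

  -- {𝟏} is P-Boolean since its annihilator is all of P.
  𝟏ᴮ : PB
  𝟏ᴮ = mkPB One-special One⊆P (Generates-mono P⊆AnnOne (λ _ _ → id))
    where
      One⊆P : One L ⊆ P
      One⊆P x≡𝟏 = subst P (sym x≡𝟏) (contains-𝟏 SP)
      One-special : Special L (One L)
      One-special = special-in-P One⊆P refl
        (λ {x} {y} x≡𝟏 x≤y → 𝟏≤⇒≡𝟏 (subst (_≤ y) x≡𝟏 x≤y))
        (λ x≡𝟏 y≡𝟏 m → meet-of-𝟏 m x≡𝟏 y≡𝟏)
      P⊆AnnOne : P ⊆ (One L ∪ Ann (One L))
      P⊆AnnOne {x} x∈P = inj₂ (x∈P , λ g≡𝟏 → trans (cong (x ∨_) g≡𝟏) (top x))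

  -- Q → P is P-Boolean because Q ⊆ (Q → P) → P, so its generators contain Q's.
  ¬ᴮ : PB → PB
  ¬ᴮ Q = mkPB (Ann-special ∣ Q ∣) proj₁
    (Generates-mono [ inj₂ ∘ Ann-swap (⊆P Q) id , inj₁ ] (generated Q))

  -- Q ∩ R is P-Boolean: an element x ∈ P is reached from Q ∩ R and its
  -- annihilator by applying the induction principle for Q, and inside it
  -- the one for R.
  _∩ᴮ_ : PB → PB → PB
  Q ∩ᴮ R = mkPB (∩-special (special Q) (⊆P Q) (special R)) (⊆P Q ∘ proj₁) generates
    where
      generates : Generates ((∣ Q ∣ ∩ ∣ R ∣) ∪ Ann (∣ Q ∣ ∩ ∣ R ∣)) P
      generates T ST gens {x} x∈P =
        P-Boolean-above Q ST x∈P (≤-refl x) q-case (annihilating ∘ Ann-antitone proj₁)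
        where
          annihilating : ∀ {h c} → h ∈ Ann (∣ Q ∣ ∩ ∣ R ∣) → h ∨ c ∈ T
          annihilating h = ∨-closed ST _ (gens (inj₂ h))
          q-case : ∀ {q} → q ∈ ∣ Q ∣ → q ∨ x ∈ T
          q-case {q} q∈Q =
            P-Boolean-above R ST x∈P (y≤x∨y q x) r-case (annihilating ∘ Ann-antitone proj₂)
            where
              r-case : ∀ {r} → r ∈ ∣ R ∣ → r ∨ (q ∨ x) ∈ T
              r-case {r} r∈R = subst T (∨-assoc r q x)
                (∨-closed ST x (gens (inj₁ (up Q q∈Q (y≤x∨y r q) , up R r∈R (x≤x∨y r q)))))

  -- Q ∨ R is P-Boolean: same scheme, using that an element annihilating
  -- both Q and R annihilates Q ∨ R.
  _∨ᴮ_ : PB → PB → PB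
  Q ∨ᴮ R = mkPB (Gen-special (gens⊆P Q R)) (Gen-in-P (gens⊆P Q R)) generates
    where
      G = Gen (∣ Q ∣ ∪ ∣ R ∣)
      generates : Generates (G ∪ Ann G) P
      generates T ST gens {x} x∈P =
        P-Boolean-above Q ST x∈P (≤-refl x) (generator ∘ inj₁) h-case
        where
          generator : ∀ {g c} → g ∈ (∣ Q ∣ ∪ ∣ R ∣) → g ∨ c ∈ T
          generator g = ∨-closed ST _ (gens (inj₁ (gen g)))
          h-case : ∀ {h} → h ∈ Ann ∣ Q ∣ → h ∨ x ∈ T
          h-case {h} h⊥Q = P-Boolean-above R ST x∈P (y≤x∨y h x) (generator ∘ inj₂) k-case
            where
              k∨h⊥G : ∀ {k} → k ∈ Ann ∣ R ∣ → (k ∨ h) ∈ Ann G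
              k∨h⊥G {k} k⊥R = Ann-generated (gens⊆P Q R) Gen-least (Ann-∪
                (upClosed (Ann-special _) h⊥Q (y≤x∨y k h) , upClosed (Ann-special _) k⊥R (x≤x∨y k h)))
              k-case : ∀ {k} → k ∈ Ann ∣ R ∣ → k ∨ (h ∨ x) ∈ T
              k-case {k} k⊥R = subst T (∨-assoc k h x) (∨-closed ST x (gens (inj₂ (k∨h⊥G k⊥R))))

  _≈_ : PB → PB → Set ℓ
  _≈_ = _≈B_ L {P}

  ≈-isEquivalence : IsEquivalence _≈_
  ≈-isEquivalence = record
    { refl  = id , id
    ; sym   = λ (f , g) → g , f
    ; trans = λ (f , g) (f′ , g′) → f′ ∘ f , g ∘ g′
    }

  ∩ᴮ-comm : ∀ Q R → (Q ∩ᴮ R) ≈ (R ∩ᴮ Q)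
  ∩ᴮ-comm Q R = (λ (q , r) → r , q) , (λ (r , q) → q , r)

  ∩ᴮ-assoc : ∀ Q R S → ((Q ∩ᴮ R) ∩ᴮ S) ≈ (Q ∩ᴮ (R ∩ᴮ S))
  ∩ᴮ-assoc Q R S = (λ ((q , r) , s) → q , (r , s)) , (λ (q , (r , s)) → (q , r) , s)

  ∩ᴮ-cong : ∀ {Q Q′ R R′} → Q ≈ Q′ → R ≈ R′ → (Q ∩ᴮ R) ≈ (Q′ ∩ᴮ R′)
  ∩ᴮ-cong (f , f′) (g , g′) = (λ (q , r) → f q , g r) , (λ (q , r) → f′ q , g′ r)

  ∨ᴮ-comm : ∀ Q R → (Q ∨ᴮ R) ≈ (R ∨ᴮ Q)
  ∨ᴮ-comm Q R = Gen-⊆ (gens⊆P R Q) (gen ∘ [ inj₂ , inj₁ ]) , Gen-⊆ (gens⊆P Q R) (gen ∘ [ inj₂ , inj₁ ])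

  ∨ᴮ-assoc : ∀ Q R S → ((Q ∨ᴮ R) ∨ᴮ S) ≈ (Q ∨ᴮ (R ∨ᴮ S))
  ∨ᴮ-assoc Q R S =
    Gen-⊆ (gens⊆P Q (R ∨ᴮ S))
      [ Gen-⊆ (gens⊆P Q (R ∨ᴮ S)) [ gen ∘ inj₁ , gen ∘ inj₂ ∘ gen ∘ inj₁ ] , gen ∘ inj₂ ∘ gen ∘ inj₂ ] ,
    Gen-⊆ (gens⊆P (Q ∨ᴮ R) S)
      [ gen ∘ inj₁ ∘ gen ∘ inj₁ , Gen-⊆ (gens⊆P (Q ∨ᴮ R) S) [ gen ∘ inj₁ ∘ gen ∘ inj₂ , gen ∘ inj₂ ] ]

  ∨ᴮ-cong : ∀ {Q Q′ R R′} → Q ≈ Q′ → R ≈ R′ → (Q ∨ᴮ R) ≈ (Q′ ∨ᴮ R′)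
  ∨ᴮ-cong {Q} {Q′} {R} {R′} (f , f′) (g , g′) =
    Gen-⊆ (gens⊆P Q′ R′) [ gen ∘ inj₁ ∘ f , gen ∘ inj₂ ∘ g ] ,
    Gen-⊆ (gens⊆P Q R) [ gen ∘ inj₁ ∘ f′ , gen ∘ inj₂ ∘ g′ ]

  ∩ᴮ-absorbs-∨ᴮ : ∀ Q R → (Q ∩ᴮ (Q ∨ᴮ R)) ≈ Q
  ∩ᴮ-absorbs-∨ᴮ Q R = proj₁ , (λ q → q , gen (inj₁ q))

  ∨ᴮ-absorbs-∩ᴮ : ∀ Q R → (Q ∨ᴮ (Q ∩ᴮ R)) ≈ Q
  ∨ᴮ-absorbs-∩ᴮ Q R = Gen-least _ (special Q) [ id , proj₁ ] , gen ∘ inj₁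

  -- (R ∨ S) ∩ Q = (R ∩ Q) ∨ (S ∩ Q): for x ∈ Q, every generator g of R ∨ S
  -- has g ∨ x in (R ∩ Q) ∪ (S ∩ Q), so the induction principle applies.
  ∩ᴮ-distribʳ-∨ᴮ : ∀ Q R S → ((R ∨ᴮ S) ∩ᴮ Q) ≈ ((R ∩ᴮ Q) ∨ᴮ (S ∩ᴮ Q))
  ∩ᴮ-distribʳ-∨ᴮ Q R S = to , from
    where
      RQ∪SQ⊆P = gens⊆P (R ∩ᴮ Q) (S ∩ᴮ Q)
      to : ((∣ R ∨ᴮ S ∣) ∩ ∣ Q ∣) ⊆ ∣ (R ∩ᴮ Q) ∨ᴮ (S ∩ᴮ Q) ∣
      to {x} (g , x∈Q) = generated-above (gens⊆P R S) Gen-least (Gen-special RQ∪SQ⊆P) g (≤-refl x) joined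
        where
          joined : ∀ {a} → a ∈ (∣ R ∣ ∪ ∣ S ∣) → a ∨ x ∈ ∣ (R ∩ᴮ Q) ∨ᴮ (S ∩ᴮ Q) ∣
          joined {r} (inj₁ r∈R) = gen (inj₁ (up R r∈R (x≤x∨y r x) , up Q x∈Q (y≤x∨y r x)))
          joined {s} (inj₂ s∈S) = gen (inj₂ (up S s∈S (x≤x∨y s x) , up Q x∈Q (y≤x∨y s x)))
      from : ∣ (R ∩ᴮ Q) ∨ᴮ (S ∩ᴮ Q) ∣ ⊆ ((∣ R ∨ᴮ S ∣) ∩ ∣ Q ∣)
      from = Gen-least _ (∩-special (Gen-special (gens⊆P R S)) (Gen-in-P (gens⊆P R S)) (special Q))
        [ (λ (r , q) → gen (inj₁ r) , q) , (λ (s , q) → gen (inj₂ s) , q) ]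

  ∩ᴮ-complementʳ : ∀ Q → (Q ∩ᴮ ¬ᴮ Q) ≈ 𝟏ᴮ
  ∩ᴮ-complementʳ Q =
    (λ {x} (q , (_ , h⊥Q)) → trans (sym (∨-idem x)) (h⊥Q q)) ,
    (λ x≡𝟏 → subst ∣ Q ∩ᴮ ¬ᴮ Q ∣ (sym x≡𝟏) (contains-𝟏 (special (Q ∩ᴮ ¬ᴮ Q))))

  ∨ᴮ-complementʳ : ∀ Q → (Q ∨ᴮ ¬ᴮ Q) ≈ Pᴮ
  ∨ᴮ-complementʳ Q = Gen-in-P (gens⊆P Q (¬ᴮ Q)) , generated Q _ (special (Q ∨ᴮ ¬ᴮ Q)) gen

  ¬ᴮ-cong : ∀ {Q R} → Q ≈ R → ¬ᴮ Q ≈ ¬ᴮ R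
  ¬ᴮ-cong (f , g) = Ann-antitone g , Ann-antitone f

  isLattice : IsLattice _≈_ _∩ᴮ_ _∨ᴮ_
  isLattice = record
    { isEquivalence = ≈-isEquivalence
    ; ∨-comm        = ∩ᴮ-comm
    ; ∨-assoc       = ∩ᴮ-assoc
    ; ∨-cong        = λ {Q} {Q′} {R} {R′} → ∩ᴮ-cong {Q} {Q′} {R} {R′}
    ; ∧-comm        = ∨ᴮ-comm
    ; ∧-assoc       = ∨ᴮ-assoc
    ; ∧-cong        = λ {Q} {Q′} {R} {R′} → ∨ᴮ-cong {Q} {Q′} {R} {R′}
    ; absorptive    = ∩ᴮ-absorbs-∨ᴮ , ∨ᴮ-absorbs-∩ᴮ
    }

  pBooleanAlgebra : PBooleanAlgebra L P
  pBooleanAlgebra = record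
    { _meet_ = _∨ᴮ_
    ; _join_ = _∩ᴮ_
    ; compl  = ¬ᴮ
    ; ⊤B     = 𝟏ᴮ
    ; ⊥B     = Pᴮ
    ; isBooleanAlgebra = isBooleanAlgebraʳ record
        { isDistributiveLattice = isDistributiveLatticeʳʲᵐ record
            { isLattice    = isLattice
            ; ∨-distribʳ-∧ = ∩ᴮ-distribʳ-∨ᴮ
            }
        ; ∨-complementʳ = ∩ᴮ-complementʳ
        ; ∧-complementʳ = ∨ᴮ-complementʳ
        ; ¬-cong        = λ {Q} {R} → ¬ᴮ-cong {Q} {R}
        }
    ; order-is-reverse-inclusion = λ Q R →
        (λ (Q∨R⊆Q , _) r → Q∨R⊆Q (gen (inj₂ r))) ,
        (λ R⊆Q → Gen-least _ (special Q) [ id , R⊆Q ] , gen ∘ inj₁)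
    ; meet-is-∨  = λ Q R → Gen-is-join (⊆P Q) (⊆P R)
    ; join-is-∩  = λ Q R → id , id
    ; top-is-𝟏   = id , id
    ; bot-is-P   = id , id
    ; compl-is-→ = λ Q → id , id
    }

theorem7p51 : {ℓ : Level} (L : CubicAlgebra ℓ) (P : Pred (CubicAlgebra.Carrier L) ℓ) →
    Special L P → PBooleanAlgebra L P
theorem7p51 L P SP = SpecialSubalgebrasOf.pBooleanAlgebra L P SP
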